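{- Let $\alpha=(0^{i_1},s_1,0^{i_2},s_2,\ldots,0^{i_k},s_k)$ be a left weak composition, where $k\geq 1$, $s_p\geq 1$ and $i_p\geq 0$ for $p=1,\ldots,k$, and $0^{i}$ denotes a string of $i$ zero entries. Then $$M_\alpha=\sum_{1\leq n_1<n_2<\cdots<n_k}\binom{n_1-1}{i_1}\binom{n_2-n_1-1}{i_2}\cdots\binom{n_k-n_{k-1}-1}{i_k}\,x_{n_1}^{s_1}x_{n_2}^{s_2}\cdots x_{n_k}^{s_k},$$ with the convention $\binom{m}{n}=0$ if $m<n$.
   Context: Let $x_1,x_2,\ldots$ be countably many commuting variables. A weak composition is a finite sequence of nonnegative integers; a left weak composition is a nonempty weak composition whose last entry is positive. For a left weak composition $\alpha=(\alpha_1,\ldots,\alpha_r)$, the LWC monomial quasi-symmetric function is the formal power series $M_\alpha=\sum_{1\leq n_1<\cdots<n_r}x_{n_1}^{\alpha_1}\cdots x_{n_r}^{\alpha_r}$ (with $x^0=1$). -}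

module Defs where

open import Data.Nat using (ℕ; zero; suc; _+_; _*_; _∸_; _≡ᵇ_)
open import Data.Nat.Properties using (_≟_)
open import Data.Nat.Combinatorics using (_C_)
open import Data.Bool using (if_then_else_)
open import Data.List using (List; []; _∷_; [_]; _++_; map; upTo; length; filter; zipWith; replicate; concat)
open import Data.List.Properties using (≡-dec)
open import Data.Nat.ListAction using (sum)
open import Data.Vec using (Vec; toList) renaming (zipWith to vzipWith)

-- A monomial x_1^{m_1} x_2^{m_2} ... x_L^{m_L} is represented by the list
-- of exponents (m_1, ..., m_L); all variables x_p with p > L have exponent 0.
Monomial : Set
Monomial = List ℕ

positions : ℕ → List ℕ
positions L = map suc (upTo L)

choose : List ℕ → ℕ → List (List ℕ)
choose xs zero = [ [] ]
choose [] (suc r) = []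
choose (x ∷ xs) (suc r) = map (x ∷_) (choose xs r) ++ choose xs (suc r)

expo : List ℕ → List ℕ → ℕ → ℕ
expo ns as p = sum (zipWith (λ n a → if n ≡ᵇ p then a else 0) ns as)

mono : ℕ → List ℕ → List ℕ → Monomial
mono L ns as = map (expo ns as) (positions L)

-- Coefficient of the monomial m in
--   M_α = Σ_{1 ≤ n_1 < ... < n_r} x_{n_1}^{α_1} ... x_{n_r}^{α_r},
-- i.e. the number of strictly increasing (n_1,...,n_r) whose monomial is m.
-- For a left weak composition α (last entry positive) any such tuple has
-- n_r ≤ length m, so only tuples with entries in 1..length m need counting.
coeffM : List ℕ → Monomial → ℕ
coeffM α m = length (filter (λ ns → ≡-dec _≟_ (mono (length m) ns α) m)
                            (choose (positions (length m)) (length α)))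

-- binomial weight  C(n_1-1, i_1) C(n_2-n_1-1, i_2) ... C(n_k-n_{k-1}-1, i_k)
-- (prev = n_0 = 0); _C_ from the stdlib is 0 when the lower index exceeds
-- the upper one.
weight : ℕ → List ℕ → List ℕ → ℕ
weight prev (n ∷ ns) (i ∷ is) = ((n ∸ prev ∸ 1) C i) * weight n ns is
weight prev _ _ = 1

-- Coefficient of the monomial m in
--   Σ_{1 ≤ n_1 < ... < n_k} C(n_1-1,i_1)...C(n_k-n_{k-1}-1,i_k) x_{n_1}^{s_1}...x_{n_k}^{s_k}
-- (again only n_k ≤ length m can contribute since s_k ≥ 1).
coeffRHS : List ℕ → List ℕ → Monomial → ℕ
coeffRHS is ss m =
  sum (map (λ ns → weight 0 ns is)
           (filter (λ ns → ≡-dec _≟_ (mono (length m) ns ss) m)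
                   (choose (positions (length m)) (length ss))))

buildα : {k : ℕ} → Vec ℕ k → Vec ℕ k → List ℕ
buildα is ss = concat (toList (vzipWith (λ i s → replicate i 0 ++ [ s ]) is ss))

-- A zero entry of α imposes no condition on the monomial: it only has to be
-- placed at some variable that the monomial does not use. So we compute the
-- coefficient of a monomial by scanning its variables from the left and, at
-- each one, deciding whether the next entry of α goes there. When the next
-- block 0^i s of α lands with s at position n, its i zeros are spread over the
-- n − n′ − 1 unused positions since the previous part n′, and Pascal's rule
-- turns this choice into the weight C(n − n′ − 1, i) of the right-hand side.

module Submission where

open import Defs
open import Data.Nat using (ℕ; _≤_)
open import Data.Vec using (Vec; toList)
open import Data.Vec.Relation.Unary.All using (All)
open import Relation.Binary.PropositionalEquality using (_≡_)

open import Data.Bool using (true; false; if_then_else_)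
open import Data.Bool.Properties using (T-≡; ¬-not)
open import Data.Nat using (zero; suc; _+_; _*_; _∸_; _≡ᵇ_; _<_)
open import Data.Nat.Properties
  using (_≟_; ≡ᵇ⇒≡; ≡⇒≡ᵇ; <⇒≢; >⇒≢; <-trans; n<1+n; +-identityʳ; +-suc; m+n∸n≡m; *-zeroʳ; *-distribˡ-+)
open import Data.Nat.Combinatorics using (_C_; nCk+nC[k+1]≡[n+1]C[k+1])
open import Data.Nat.ListAction using (sum)
open import Data.Nat.ListAction.Properties using (sum-++)
open import Data.Nat.Tactic.RingSolver using (solve-∀)
open import Data.List using (List; []; _∷_; [_]; _++_; map; applyUpTo; length; filter; replicate)
open import Data.List.Properties
  using (≡-dec; ∷-injectiveˡ; ∷-injectiveʳ; filter-++; filter-≐; filter-none; map-++; map-∘; map-cong; map-cong-local; map-upTo; ++-assoc)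
open import Data.List.Relation.Unary.All as ListAll using ([]; _∷_)
open import Data.List.Relation.Unary.All.Properties using (++⁺; map⁺)
open import Data.Vec using ([]; _∷_)
open import Data.Product using (_,_)
open import Function using (_∘_; const)
open import Function.Bundles using (Equivalence)
open import Relation.Nullary using (does)
open import Relation.Binary.PropositionalEquality using (_≢_; refl; sym; trans; cong; cong₂; module ≡-Reasoning)

open ≡-Reasoning

≡ᵇ-refl : ∀ n → (n ≡ᵇ n) ≡ true
≡ᵇ-refl n = Equivalence.to T-≡ (≡⇒≡ᵇ n n refl)

≢⇒≡ᵇ-false : ∀ {m n} → m ≢ n → (m ≡ᵇ n) ≡ false
≢⇒≡ᵇ-false {m} {n} m≢n = ¬-not (λ eq → m≢n (≡ᵇ⇒≡ m n (Equivalence.from T-≡ eq)))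

δ : ℕ → ℕ → ℕ
δ a c = if a ≡ᵇ c then 1 else 0

δ-elim : ∀ {a c x y} → (a ≡ c → x ≡ y) → (a ≢ c → x ≡ 0) → x ≡ δ a c * y
δ-elim {a} {c} eq neq with a ≡ᵇ c | ≡ᵇ⇒≡ a c | ≡⇒≡ᵇ a c
... | true  | a≡c | _   = trans (eq (a≡c _)) (sym (+-identityʳ _))
... | false | _   | a≢c = neq a≢c

sum-map-*ˡ : ∀ k ns → sum (map (k *_) ns) ≡ k * sum ns
sum-map-*ˡ k [] = sym (*-zeroʳ k)
sum-map-*ˡ k (n ∷ ns) = trans (cong (k * n +_) (sum-map-*ˡ k ns)) (sym (*-distribˡ-+ k n (sum ns)))

length≡sum-const-1 : ∀ {A : Set} (xs : List A) → length xs ≡ sum (map (const 1) xs)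
length≡sum-const-1 [] = refl
length≡sum-const-1 (x ∷ xs) = cong suc (length≡sum-const-1 xs)

weightedCount : {A : Set} → (A → ℕ) → (A → List ℕ) → List ℕ → List A → ℕ
weightedCount w f m xs = sum (map w (filter (λ x → ≡-dec _≟_ (f x) m) xs))

module _ {A : Set} (w : A → ℕ) (f : A → List ℕ) (m : List ℕ) where

  weightedCount-++ : ∀ xs ys →
    weightedCount w f m (xs ++ ys) ≡ weightedCount w f m xs + weightedCount w f m ys
  weightedCount-++ xs ys = begin
    sum (map w (filter P? (xs ++ ys)))                 ≡⟨ cong (sum ∘ map w) (filter-++ P? xs ys) ⟩
    sum (map w (filter P? xs ++ filter P? ys))          ≡⟨ cong sum (map-++ w (filter P? xs) _) ⟩
    sum (map w (filter P? xs) ++ map w (filter P? ys))  ≡⟨ sum-++ (map w (filter P? xs)) _ ⟩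
    weightedCount w f m xs + weightedCount w f m ys     ∎
    where P? = λ x → ≡-dec _≟_ (f x) m

  weightedCount-map : ∀ {B : Set} (h : B → A) xs →
    weightedCount w f m (map h xs) ≡ weightedCount (w ∘ h) (f ∘ h) m xs
  weightedCount-map h [] = refl
  weightedCount-map h (x ∷ xs) with does (≡-dec _≟_ (f (h x)) m)
  ... | true = cong (w (h x) +_) (weightedCount-map h xs)
  ... | false = weightedCount-map h xs

  weightedCount-*ˡ : ∀ k xs → weightedCount (λ x → k * w x) f m xs ≡ k * weightedCount w f m xs
  weightedCount-*ˡ k xs = trans (cong sum (map-∘ ys)) (sum-map-*ˡ k (map w ys))
    where ys = filter (λ x → ≡-dec _≟_ (f x) m) xs

module _ {A : Set} (w : A → ℕ) where

  weightedCount-cong : ∀ {f g : A → List ℕ} m {xs} → ListAll.All (λ x → f x ≡ g x) xs →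
    weightedCount w f m xs ≡ weightedCount w g m xs
  weightedCount-cong m [] = refl
  weightedCount-cong {f} {g} m {x ∷ xs} (fx≡gx ∷ eqs) with f x | fx≡gx
  ... | _ | refl with does (≡-dec _≟_ (g x) m)
  ...   | true  = cong (w x +_) (weightedCount-cong m eqs)
  ...   | false = weightedCount-cong m eqs

  weightedCount-∷ : ∀ (g : A → List ℕ) c′ c m xs →
    weightedCount w (λ x → c′ ∷ g x) (c ∷ m) xs ≡ δ c′ c * weightedCount w g m xs
  weightedCount-∷ g c′ c m xs = δ-elim heads-equal heads-differ
    where
    P? = λ x → ≡-dec _≟_ (c′ ∷ g x) (c ∷ m)
    heads-equal : c′ ≡ c → weightedCount w (λ x → c′ ∷ g x) (c ∷ m) xs ≡ weightedCount w g m xs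
    heads-equal refl = cong (sum ∘ map w) (filter-≐ P? (λ x → ≡-dec _≟_ (g x) m) (∷-injectiveʳ , cong (c ∷_)) xs)
    heads-differ : c′ ≢ c → weightedCount w (λ x → c′ ∷ g x) (c ∷ m) xs ≡ 0
    heads-differ c′≢c = cong (sum ∘ map w) (filter-none P? (ListAll.universal (λ _ → c′≢c ∘ ∷-injectiveˡ) xs))

expo-∷-≢ : ∀ {n p} a ns as → n ≢ p → expo (n ∷ ns) (a ∷ as) p ≡ expo ns as p
expo-∷-≢ _ _ _ n≢p rewrite ≢⇒≡ᵇ-false n≢p = refl

expo-∉ : ∀ {p ns} as → ListAll.All (_≢ p) ns → expo ns as p ≡ 0
expo-∉ _ [] = refl
expo-∉ [] (_ ∷ _) = refl
expo-∉ (a ∷ as) (_∷_ {xs = ns} n≢p ns≢p) = trans (expo-∷-≢ a ns as n≢p) (expo-∉ as ns≢p)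

expo-∷-self : ∀ {n ns} a as → ListAll.All (_≢ n) ns → expo (n ∷ ns) (a ∷ as) n ≡ a
expo-∷-self {n} a as ns≢n rewrite ≡ᵇ-refl n = trans (cong (a +_) (expo-∉ as ns≢n)) (+-identityʳ a)

choose-All : ∀ {P : ℕ → Set} {xs} r → ListAll.All P xs → ListAll.All (ListAll.All P) (choose xs r)
choose-All zero _ = [] ∷ []
choose-All {xs = []} (suc r) [] = []
choose-All {xs = x ∷ xs} (suc r) (px ∷ pxs) =
  ++⁺ (map⁺ (ListAll.map (px ∷_) (choose-All r pxs))) (choose-All (suc r) pxs)

window : ℕ → ℕ → List ℕ
window q zero = []
window q (suc L) = suc q ∷ window (suc q) L

window-above : ∀ q L → ListAll.All (q <_) (window q L)
window-above q zero = []
window-above q (suc L) = n<1+n q ∷ ListAll.map (<-trans (n<1+n q)) (window-above (suc q) L)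

applyUpTo-window : ∀ {f : ℕ → ℕ} q L → (∀ j → f j ≡ suc (q + j)) → applyUpTo f L ≡ window q L
applyUpTo-window q zero _ = refl
applyUpTo-window q (suc L) f≗ =
  cong₂ _∷_ (trans (f≗ 0) (cong suc (+-identityʳ q))) (applyUpTo-window (suc q) L (λ j → trans (f≗ (suc j)) (cong suc (+-suc q j))))

positions≡window : ∀ L → positions L ≡ window 0 L
positions≡window L = trans (map-upTo suc L) (applyUpTo-window 0 L (λ _ → refl))

-- The coefficient of x_{q+1}^{m_1} ⋯ x_{q+L}^{m_L} (L = length m) in
-- Σ w ns · x_{ns}^α over increasing ns with entries in {q+1, …, q+L}.
windowCoeff : (List ℕ → ℕ) → ℕ → List ℕ → Monomial → ℕ
windowCoeff w q α m =
  weightedCount w (λ ns → map (expo ns α) (window q (length m))) m (choose (window q (length m)) (length α))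

windowCoeff-*ˡ : ∀ k w q α m → windowCoeff (λ ns → k * w ns) q α m ≡ k * windowCoeff w q α m
windowCoeff-*ˡ k w q α m =
  weightedCount-*ˡ w (λ ns → map (expo ns α) (window q (length m))) m k (choose (window q (length m)) (length α))

windowCoeff-congʷ : ∀ {w v} → (∀ ns → w ns ≡ v ns) → ∀ q α m → windowCoeff w q α m ≡ windowCoeff v q α m
windowCoeff-congʷ w≗v q α m = cong sum (map-cong w≗v
  (filter (λ ns → ≡-dec _≟_ (map (expo ns α) (window q (length m))) m) (choose (window q (length m)) (length α))))

-- Split the tuples ns according to whether they use the first position q+1.
windowCoeff-∷ : ∀ w q a α c m →
  windowCoeff w q (a ∷ α) (c ∷ m) ≡
  δ a c * windowCoeff (w ∘ (suc q ∷_)) (suc q) α m + δ 0 c * windowCoeff w (suc q) (a ∷ α) m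
windowCoeff-∷ w q a α c m = begin
  weightedCount w key (c ∷ m) (map (suc q ∷_) (choose R r) ++ choose R (suc r))
    ≡⟨ weightedCount-++ w key (c ∷ m) (map (suc q ∷_) (choose R r)) _ ⟩
  weightedCount w key (c ∷ m) (map (suc q ∷_) (choose R r)) + weightedCount w key (c ∷ m) (choose R (suc r))
    ≡⟨ cong₂ _+_ chosen skipped ⟩
  δ a c * windowCoeff (w ∘ (suc q ∷_)) (suc q) α m + δ 0 c * windowCoeff w (suc q) (a ∷ α) m ∎
  where
  R = window (suc q) (length m)
  r = length α
  key = λ ns → map (expo ns (a ∷ α)) (suc q ∷ R)

  above : ∀ r′ → ListAll.All (ListAll.All (suc q <_)) (choose R r′)
  above r′ = choose-All r′ (window-above (suc q) (length m))

  chosen : weightedCount w key (c ∷ m) (map (suc q ∷_) (choose R r)) ≡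
           δ a c * windowCoeff (w ∘ (suc q ∷_)) (suc q) α m
  chosen = begin
    weightedCount w key (c ∷ m) (map (suc q ∷_) (choose R r))
      ≡⟨ weightedCount-map w key (c ∷ m) (suc q ∷_) (choose R r) ⟩
    weightedCount (w ∘ (suc q ∷_)) (key ∘ (suc q ∷_)) (c ∷ m) (choose R r)
      ≡⟨ weightedCount-cong (w ∘ (suc q ∷_)) (c ∷ m) (ListAll.map head-a (above r)) ⟩
    weightedCount (w ∘ (suc q ∷_)) (λ ns → a ∷ map (expo ns α) R) (c ∷ m) (choose R r)
      ≡⟨ weightedCount-∷ (w ∘ (suc q ∷_)) (λ ns → map (expo ns α) R) a c m (choose R r) ⟩
    δ a c * windowCoeff (w ∘ (suc q ∷_)) (suc q) α m ∎
    where
    head-a : ∀ {ns} → ListAll.All (suc q <_) ns → key (suc q ∷ ns) ≡ a ∷ map (expo ns α) R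
    head-a {ns} ns>q = cong₂ _∷_ (expo-∷-self a α (ListAll.map >⇒≢ ns>q))
                            (map-cong-local (ListAll.map (expo-∷-≢ a ns α ∘ <⇒≢) (window-above (suc q) (length m))))

  skipped : weightedCount w key (c ∷ m) (choose R (suc r)) ≡ δ 0 c * windowCoeff w (suc q) (a ∷ α) m
  skipped = begin
    weightedCount w key (c ∷ m) (choose R (suc r))
      ≡⟨ weightedCount-cong w (c ∷ m) (ListAll.map head-0 (above (suc r))) ⟩
    weightedCount w (λ ns → 0 ∷ map (expo ns (a ∷ α)) R) (c ∷ m) (choose R (suc r))
      ≡⟨ weightedCount-∷ w (λ ns → map (expo ns (a ∷ α)) R) 0 c m (choose R (suc r)) ⟩
    δ 0 c * windowCoeff w (suc q) (a ∷ α) m ∎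
    where
    head-0 : ∀ {ns} → ListAll.All (suc q <_) ns → key ns ≡ 0 ∷ map (expo ns (a ∷ α)) R
    head-0 {ns} ns>q = cong (_∷ map (expo ns (a ∷ α)) R) (expo-∉ (a ∷ α) (ListAll.map >⇒≢ ns>q))

-- Σ f j · H (q + j + 1) m′ over the ways of writing m = 0^j ∷ s ∷ m′.
firstPartSum : (ℕ → ℕ) → ℕ → (ℕ → Monomial → ℕ) → ℕ → Monomial → ℕ
firstPartSum f s H q [] = 0
firstPartSum f s H q (c ∷ m) = δ s c * (f 0 * H (suc q) m) + δ 0 c * firstPartSum (f ∘ suc) s H (suc q) m

firstPartSum-cong : ∀ {f f′ : ℕ → ℕ} {H H′ : ℕ → Monomial → ℕ} s → (∀ j → f j ≡ f′ j) →
  (∀ q m → H q m ≡ H′ q m) → ∀ q m → firstPartSum f s H q m ≡ firstPartSum f′ s H′ q m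
firstPartSum-cong s f≗f′ H≗H′ q [] = refl
firstPartSum-cong s f≗f′ H≗H′ q (c ∷ m) =
  cong₂ (λ x y → δ s c * x + δ 0 c * y)
        (cong₂ _*_ (f≗f′ 0) (H≗H′ (suc q) m))
        (firstPartSum-cong s (f≗f′ ∘ suc) H≗H′ (suc q) m)

firstPartSum-+ : ∀ (f g : ℕ → ℕ) s H q m →
  firstPartSum (λ j → f j + g j) s H q m ≡ firstPartSum f s H q m + firstPartSum g s H q m
firstPartSum-+ f g s H q [] = refl
firstPartSum-+ f g s H q (c ∷ m) =
  trans (cong (δ s c * ((f 0 + g 0) * H (suc q) m) +_) (cong (δ 0 c *_) (firstPartSum-+ (f ∘ suc) (g ∘ suc) s H (suc q) m)))
        (distribute (δ s c) (δ 0 c) (f 0) (g 0) (H (suc q) m) _ _)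
  where
  distribute : ∀ a b x y h u v → a * ((x + y) * h) + b * (u + v) ≡ (a * (x * h) + b * u) + (a * (y * h) + b * v)
  distribute = solve-∀

windowCoeff-zeroRun : ∀ i s α q m →
  windowCoeff (const 1) q (replicate i 0 ++ s ∷ α) m ≡ firstPartSum (_C i) s (λ q′ → windowCoeff (const 1) q′ α) q m
windowCoeff-zeroRun zero s α q [] = refl
windowCoeff-zeroRun zero s α q (c ∷ m) = begin
  windowCoeff (const 1) q (s ∷ α) (c ∷ m)
    ≡⟨ windowCoeff-∷ (const 1) q s α c m ⟩
  δ s c * H (suc q) m + δ 0 c * windowCoeff (const 1) (suc q) (s ∷ α) m
    ≡⟨ cong₂ (λ x y → δ s c * x + δ 0 c * y) (sym (+-identityʳ _)) (windowCoeff-zeroRun zero s α (suc q) m) ⟩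
  firstPartSum (_C 0) s H q (c ∷ m) ∎
  where H = λ q′ → windowCoeff (const 1) q′ α
windowCoeff-zeroRun (suc i) s α q [] = refl
windowCoeff-zeroRun (suc i) s α q (c ∷ m) = begin
  windowCoeff (const 1) q (0 ∷ β) (c ∷ m)
    ≡⟨ windowCoeff-∷ (const 1) q 0 β c m ⟩
  δ 0 c * windowCoeff (const 1) (suc q) β m + δ 0 c * windowCoeff (const 1) (suc q) (0 ∷ β) m
    ≡⟨ cong₂ (λ x y → δ 0 c * x + δ 0 c * y) (windowCoeff-zeroRun i s α (suc q) m) (windowCoeff-zeroRun (suc i) s α (suc q) m) ⟩
  δ 0 c * firstPartSum (_C i) s H (suc q) m + δ 0 c * firstPartSum (_C suc i) s H (suc q) m
    ≡⟨ sym (*-distribˡ-+ (δ 0 c) _ _) ⟩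
  δ 0 c * (firstPartSum (_C i) s H (suc q) m + firstPartSum (_C suc i) s H (suc q) m)
    ≡⟨ cong (δ 0 c *_) (sym (firstPartSum-+ (_C i) (_C suc i) s H (suc q) m)) ⟩
  δ 0 c * firstPartSum (λ j → j C i + j C suc i) s H (suc q) m
    ≡⟨ cong (δ 0 c *_) (firstPartSum-cong s (λ j → nCk+nC[k+1]≡[n+1]C[k+1] j i) (λ _ _ → refl) (suc q) m) ⟩
  δ 0 c * firstPartSum (λ j → suc j C suc i) s H (suc q) m
    ≡⟨ cong (_+ δ 0 c * firstPartSum (λ j → suc j C suc i) s H (suc q) m) (sym (*-zeroʳ (δ s c))) ⟩
  firstPartSum (_C suc i) s H q (c ∷ m) ∎
  where
  β = replicate i 0 ++ s ∷ α
  H = λ q′ → windowCoeff (const 1) q′ α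

windowCoeff-weight : ∀ i s is ss g prev m →
  windowCoeff (λ ns → weight prev ns (i ∷ is)) (g + prev) (s ∷ ss) m ≡
  firstPartSum (λ j → (j + g) C i) s (λ q → windowCoeff (λ ns → weight q ns is) q ss) (g + prev) m
windowCoeff-weight i s is ss g prev [] = refl
windowCoeff-weight i s is ss g prev (c ∷ m) = begin
  windowCoeff W (g + prev) (s ∷ ss) (c ∷ m)
    ≡⟨ windowCoeff-∷ W (g + prev) s ss c m ⟩
  δ s c * windowCoeff (λ ns → ((suc g + prev ∸ prev ∸ 1) C i) * weight (suc g + prev) ns is) (suc g + prev) ss m
    + δ 0 c * windowCoeff W (suc g + prev) (s ∷ ss) m
    ≡⟨ cong₂ (λ x y → δ s c * x + δ 0 c * y)
             (windowCoeff-*ˡ ((suc g + prev ∸ prev ∸ 1) C i) (λ ns → weight (suc g + prev) ns is) (suc g + prev) ss m)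
             (windowCoeff-weight i s is ss (suc g) prev m) ⟩
  δ s c * (((suc g + prev ∸ prev ∸ 1) C i) * H (suc g + prev) m)
    + δ 0 c * firstPartSum (λ j → (j + suc g) C i) s H (suc g + prev) m
    ≡⟨ cong₂ (λ x y → δ s c * ((x C i) * H (suc g + prev) m) + δ 0 c * y)
             (cong (_∸ 1) (m+n∸n≡m (suc g) prev))
             (firstPartSum-cong s (λ j → cong (_C i) (+-suc j g)) (λ _ _ → refl) (suc g + prev) m) ⟩
  firstPartSum (λ j → (j + g) C i) s H (g + prev) (c ∷ m) ∎
  where
  W = λ ns → weight prev ns (i ∷ is)
  H = λ q → windowCoeff (λ ns → weight q ns is) q ss

windowCoeff-buildα : ∀ {k} (is ss : Vec ℕ k) q m →
  windowCoeff (const 1) q (buildα is ss) m ≡ windowCoeff (λ ns → weight q ns (toList is)) q (toList ss) m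
windowCoeff-buildα [] [] q m = windowCoeff-congʷ weight-[] q [] m
  where
  weight-[] : ∀ ns → 1 ≡ weight q ns []
  weight-[] [] = refl
  weight-[] (_ ∷ _) = refl
windowCoeff-buildα (i ∷ is) (s ∷ ss) q m = begin
  windowCoeff (const 1) q ((replicate i 0 ++ [ s ]) ++ α) m
    ≡⟨ cong (λ β → windowCoeff (const 1) q β m) (++-assoc (replicate i 0) [ s ] α) ⟩
  windowCoeff (const 1) q (replicate i 0 ++ s ∷ α) m
    ≡⟨ windowCoeff-zeroRun i s α q m ⟩
  firstPartSum (_C i) s (λ q′ → windowCoeff (const 1) q′ α) q m
    ≡⟨ firstPartSum-cong s (λ j → cong (_C i) (sym (+-identityʳ j))) (windowCoeff-buildα is ss) q m ⟩
  firstPartSum (λ j → (j + 0) C i) s (λ q′ → windowCoeff (λ ns → weight q′ ns (toList is)) q′ (toList ss)) q m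
    ≡⟨ sym (windowCoeff-weight i s (toList is) (toList ss) 0 q m) ⟩
  windowCoeff (λ ns → weight q ns (i ∷ toList is)) q (s ∷ toList ss) m ∎
  where α = buildα is ss

coeffM≡windowCoeff : ∀ α m → coeffM α m ≡ windowCoeff (const 1) 0 α m
coeffM≡windowCoeff α m = trans (length≡sum-const-1 (filter (λ ns → ≡-dec _≟_ (mono L ns α) m) (choose (positions L) (length α))))
  (cong (λ P → weightedCount (const 1) (λ ns → map (expo ns α) P) m (choose P (length α))) (positions≡window L))
  where L = length m

coeffRHS≡windowCoeff : ∀ is ss m → coeffRHS is ss m ≡ windowCoeff (λ ns → weight 0 ns is) 0 ss m
coeffRHS≡windowCoeff is ss m =
  cong (λ P → weightedCount (λ ns → weight 0 ns is) (λ ns → map (expo ns ss) P) m (choose P (length ss))) (positions≡window (length m))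

lemma3p5 : (k : ℕ) → 1 ≤ k → (is ss : Vec ℕ k) → All (1 ≤_) ss →
    (m : Monomial) →
    coeffM (buildα is ss) m ≡ coeffRHS (toList is) (toList ss) m
lemma3p5 k _ is ss _ m = begin
  coeffM (buildα is ss) m                                      ≡⟨ coeffM≡windowCoeff (buildα is ss) m ⟩
  windowCoeff (const 1) 0 (buildα is ss) m                     ≡⟨ windowCoeff-buildα is ss 0 m ⟩
  windowCoeff (λ ns → weight 0 ns (toList is)) 0 (toList ss) m ≡⟨ coeffRHS≡windowCoeff (toList is) (toList ss) m ⟨
  coeffRHS (toList is) (toList ss) m                           ∎
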